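{- Let $\alpha$ be a countable ordinal and $S$ a sierpinskisation of $\alpha$ and $\omega$. Then $[\omega]^{<\omega}$ is not embeddable (as a poset) in $I_{<\omega}(S)$.
   Context: A sierpinskisation of a countable order type $\alpha$ and $\omega$ is a poset $(S,\le)$ whose order is the intersection of two linear orders on $S$, one of type $\alpha$ and the other of type $\omega$. $I_{<\omega}(S)$ is the set of finitely generated initial segments of $S$ ordered by inclusion; $[\omega]^{<\omega}$ is the set of finite subsets of $\omega$ ordered by inclusion. An embedding is a map $f$ with $x\le y\iff f(x)\le f(y)$. -}

module Defs where

open import Data.Nat using (ℕ)
import Data.Nat as ℕ
open import Data.List using (List)
open import Data.List.Membership.Propositional using (_∈_)
open import Data.Product using (Σ; _×_; ∃)
open import Relation.Binary using (Rel; IsTotalOrder)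
open import Relation.Binary.PropositionalEquality using (_≡_; _≢_)
open import Induction.WellFounded using (WellFounded)
open import Level using (0ℓ)

-- A sierpinskisation of a countable (infinite) ordinal α and ω, up to
-- isomorphism: the underlying set is ℕ with its usual order (type ω), and
-- ≤α is a linear order on ℕ which is a well-order (order type α).
record IsWellOrder (_≤α_ : Rel ℕ 0ℓ) : Set where
  field
    isTotalOrder : IsTotalOrder _≡_ _≤α_
    wellFounded  : WellFounded (λ x y → x ≤α y × x ≢ y)

Sierp≤ : Rel ℕ 0ℓ → Rel ℕ 0ℓ
Sierp≤ _≤α_ x y = (x ℕ.≤ y) × (x ≤α y)

↓ : Rel ℕ 0ℓ → List ℕ → ℕ → Set
↓ _≤S_ F x = Σ ℕ λ y → (y ∈ F) × (x ≤S y)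

_⊆ᵖ_ : (ℕ → Set) → (ℕ → Set) → Set
P ⊆ᵖ Q = ∀ x → P x → Q x

_⊆fin_ : List ℕ → List ℕ → Set
A ⊆fin B = ∀ x → x ∈ A → x ∈ B

-- An embedding of ([ω]^{<ω}, ⊆) into (I_{<ω}(S), ⊆): each finite subset A of ω
-- is sent to the initial segment ↓ (f A) generated by the finite set f A.
IsEmbeddingInto-I<ω : Rel ℕ 0ℓ → (List ℕ → List ℕ) → Set
IsEmbeddingInto-I<ω _≤S_ f =
  ∀ A B → (A ⊆fin B → ↓ _≤S_ (f A) ⊆ᵖ ↓ _≤S_ (f B))
        × (↓ _≤S_ (f A) ⊆ᵖ ↓ _≤S_ (f B) → A ⊆fin B)

-- Call y a private point of m when y ∈ ↓ f{m} but y ∉ ↓ f(A) for every A ∌ m.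
-- Every m has one (up to double negation): otherwise each generator of f{m}
-- lies in some ↓ f(A) with m ∉ A, and the union of these finitely many A
-- gives ↓ f{m} ⊆ ↓ f(A), hence m ∈ A. A private point of m lies below no
-- private point of any m' ≠ m. Now let y be an α-minimal private point. The
-- y + 2 indices above m have private points which are pairwise distinct, so
-- one of them, z, exceeds y in ω; then z is not above y in S, so z <α y.
module Submission where

open import Defs
open import Data.Nat using (ℕ; suc; _+_; _<_; s≤s; _<?_; _≟_)
open import Data.Nat.Properties
  using (≤-refl; ≤-trans; n<1+n; ≮⇒≥; <⇒≢; <⇒≤; m≤m+n; +-cancelˡ-≡; suc-injective)
open import Data.Fin using (Fin; toℕ; fromℕ<)
import Data.Fin as Fin
open import Data.Fin.Properties as Finₚ
  using (pigeonhole; fromℕ<-injective; toℕ-injective; any?; sequence)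
open import Data.List using (List; []; _∷_; [_]; _++_)
open import Data.List.Membership.Propositional using (_∈_; _∉_)
open import Data.List.Membership.Propositional.Properties using (∈-++⁺ˡ; ∈-++⁺ʳ; ∈-++⁻)
open import Data.List.Relation.Unary.All as All using (All; []; _∷_)
open import Data.List.Relation.Unary.Any using (here)
open import Data.Product using (Σ; ∃; ∃₂; _×_; _,_; proj₁; proj₂)
open import Data.Empty using (⊥; ⊥-elim)
open import Data.Sum using (inj₁; inj₂)
import Data.Sum as Sum
open import Function using (_∘_)
open import Effect.Monad using (RawMonad)
open import Induction.WellFounded using (Acc; acc)
open import Relation.Binary using (Rel; Reflexive; Transitive; IsTotalOrder)
open import Relation.Binary.PropositionalEquality using (_≡_; _≢_; refl; sym; subst)
open import Relation.Nullary using (¬_; yes; no)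
open import Relation.Nullary.Negation using (¬¬-Monad)
open import Level using (0ℓ)

↓-downward : ∀ {_≤S_ : Rel ℕ 0ℓ} → Transitive _≤S_ →
             ∀ {F x y} → y ≤S x → ↓ _≤S_ F x → ↓ _≤S_ F y
↓-downward trans y≤x (g , g∈F , x≤g) = g , g∈F , trans y≤x x≤g

pigeonhole-< : ∀ {n} (g : Fin (suc n) → ℕ) → (∀ i → g i < n) →
               ∃₂ λ i j → i Fin.< j × g i ≡ g j
pigeonhole-< {n} g g<n with pigeonhole (n<1+n n) (λ i → fromℕ< (g<n i))
... | i , j , i<j , eq = i , j , i<j , fromℕ<-injective (g i) (g j) (g<n i) (g<n j) eq

fresh : ℕ → ∀ {n} → Fin n → ℕ
fresh m i = suc (m + toℕ i)

fresh-injective : ∀ m {n} {i j : Fin n} → fresh m i ≡ fresh m j → i ≡ j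
fresh-injective m = toℕ-injective ∘ +-cancelˡ-≡ m _ _ ∘ suc-injective

fresh-> : ∀ m {n} (i : Fin n) → m < fresh m i
fresh-> m i = s≤s (m≤m+n m (toℕ i))

Sierp≤-refl : ∀ {_≤α_ : Rel ℕ 0ℓ} → Reflexive _≤α_ → Reflexive (Sierp≤ _≤α_)
Sierp≤-refl ≤α-refl = ≤-refl , ≤α-refl

Sierp≤-trans : ∀ {_≤α_ : Rel ℕ 0ℓ} → Transitive _≤α_ → Transitive (Sierp≤ _≤α_)
Sierp≤-trans ≤α-trans (x≤y , x≤αy) (y≤z , y≤αz) = ≤-trans x≤y y≤z , ≤α-trans x≤αy y≤αz

module PrivatePoints {_≤S_ : Rel ℕ 0ℓ}
                     (≤S-refl : Reflexive _≤S_) (≤S-trans : Transitive _≤S_)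
                     (f : List ℕ → List ℕ) (f-embedding : IsEmbeddingInto-I<ω _≤S_ f) where

  I : List ℕ → ℕ → Set
  I A = ↓ _≤S_ (f A)

  Private : ℕ → ℕ → Set
  Private m y = I [ m ] y × (∀ A → m ∉ A → ¬ I A y)

  CoveredAvoiding : ℕ → ℕ → Set
  CoveredAvoiding m y = Σ (List ℕ) λ A → m ∉ A × I A y

  I-mono : ∀ {A B} → A ⊆fin B → I A ⊆ᵖ I B
  I-mono {A} {B} = proj₁ (f-embedding A B)

  I-reflects : ∀ {A B} → I A ⊆ᵖ I B → A ⊆fin B
  I-reflects {A} {B} = proj₂ (f-embedding A B)

  covering-union : ∀ {m L} → All (CoveredAvoiding m) L →
                   Σ (List ℕ) λ A → m ∉ A × All (I A) L
  covering-union [] = [] , (λ ()) , []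
  covering-union ((A , m∉A , y∈IA) ∷ covers) with covering-union covers
  ... | B , m∉B , all∈IB =
    A ++ B , Sum.[ m∉A , m∉B ] ∘ ∈-++⁻ A ,
    (I-mono (λ _ → ∈-++⁺ˡ) _ y∈IA ∷ All.map (I-mono (λ _ → ∈-++⁺ʳ A) _) all∈IB)

  private-exists : ∀ m → ¬ ¬ ∃ (Private m)
  private-exists m noPrivate = covers (refute ∘ covering-union)
    where
    generator-covered : ∀ {g} → g ∈ f [ m ] → ¬ ¬ CoveredAvoiding m g
    generator-covered {g} g∈ uncovered =
      noPrivate (g , (g , g∈ , ≤S-refl) , λ A m∉A g∈IA → uncovered (A , m∉A , g∈IA))

    covers : ¬ ¬ All (CoveredAvoiding m) (f [ m ])
    covers = All.sequenceM 0ℓ ¬¬-Monad (All.tabulate generator-covered)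

    refute : (Σ (List ℕ) λ A → m ∉ A × All (I A) (f [ m ])) → ⊥
    refute (A , m∉A , gens∈IA) = m∉A (I-reflects I[m]⊆IA m (here refl))
      where
      I[m]⊆IA : I [ m ] ⊆ᵖ I A
      I[m]⊆IA x (g , g∈ , x≤g) = ↓-downward ≤S-trans x≤g (All.lookup gens∈IA g∈)

  private-≤⇒≡ : ∀ {m m' y z} → Private m y → Private m' z → y ≤S z → m ≡ m'
  private-≤⇒≡ {m} {m'} (_ , y∉) (z∈I[m'] , _) y≤z with m ≟ m'
  ... | yes m≡m' = m≡m'
  ... | no m≢m'  =
    ⊥-elim (y∉ [ m' ] (λ { (here e) → m≢m' e }) (↓-downward ≤S-trans y≤z z∈I[m']))

module Sierpinskisation {_≤α_ : Rel ℕ 0ℓ} (α-wellOrder : IsWellOrder _≤α_)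
                        {f : List ℕ → List ℕ}
                        (f-embedding : IsEmbeddingInto-I<ω (Sierp≤ _≤α_) f) where

  open IsWellOrder α-wellOrder
  open IsTotalOrder isTotalOrder using (total) renaming (refl to ≤α-refl; trans to ≤α-trans)
  open PrivatePoints (Sierp≤-refl {_≤α_} ≤α-refl) (Sierp≤-trans {_≤α_} ≤α-trans) f f-embedding
    public

  _<α_ : Rel ℕ 0ℓ
  x <α y = x ≤α y × x ≢ y

  no-private : ∀ {y} → Acc _<α_ y → ∀ m → ¬ Private m y
  no-private {y} (acc smaller) m y-private =
    sequence (RawMonad.rawApplicative ¬¬-Monad) (λ i → private-exists (fresh m i)) refute
    where
    refute : ((i : Fin (suc (suc y))) → ∃ (Private (fresh m i))) → ⊥
    refute privates with any? (λ i → y <? proj₁ (privates i))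
    ... | yes (i , y<z) with total y (proj₁ (privates i))
    ...   | inj₁ y≤αz =
      <⇒≢ (fresh-> m i) (private-≤⇒≡ y-private (proj₂ (privates i)) (<⇒≤ y<z , y≤αz))
    ...   | inj₂ z≤αy =
      no-private (smaller (z≤αy , <⇒≢ y<z ∘ sym)) (fresh m i) (proj₂ (privates i))
    refute privates | no nothing-above
      with pigeonhole-< (proj₁ ∘ privates) (λ i → s≤s (≮⇒≥ (nothing-above ∘ (i ,_))))
    ... | i , j , i<j , zᵢ≡zⱼ =
      Finₚ.<⇒≢ i<j (fresh-injective m
        (private-≤⇒≡ (proj₂ (privates i)) zᵢ-private-for-j (≤-refl , ≤α-refl)))
      where
      zᵢ-private-for-j : Private (fresh m j) (proj₁ (privates i))
      zᵢ-private-for-j = subst (Private (fresh m j)) (sym zᵢ≡zⱼ) (proj₂ (privates j))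

lemma2p2 : (_≤α_ : Rel ℕ 0ℓ) → IsWellOrder _≤α_ →
    ¬ (Σ (List ℕ → List ℕ) λ f → IsEmbeddingInto-I<ω (Sierp≤ _≤α_) f)
lemma2p2 _≤α_ α-wellOrder (f , f-embedding) =
  private-exists 0 λ (y , y-private) → no-private (wellFounded y) 0 y-private
  where
  open IsWellOrder α-wellOrder using (wellFounded)
  open Sierpinskisation α-wellOrder f-embedding
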